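{- Let $J$ be a finite index set and $\varphi_j$ an fPIL formula over $P$ and a De Morgan algebra $K$ for every $j\in J$. Then $$\biguplus_{j\in J}\varphi_j\equiv\bigotimes_{j\in J}(\sim\varphi_j)\otimes\Big(\bigsqcup_{j\in J}\varphi_j\Big).$$
   Context: A De Morgan algebra $(K,\vee,\wedge,0,1,\overline{\cdot})$ is a bounded distributive lattice with bottom $0$, top $1$ and a map $k\mapsto\overline k$ with $\overline{\overline k}=k$ and the De Morgan laws. $P$ is a set of ports; a $K$-fuzzy interaction is $\alpha:P\to K$ with $\alpha(p)\ne0$ for some $p$; $fC(P,K)$ is the set of nonempty (finite) sets of $K$-fuzzy interactions. fPIL formulas: $\varphi::=true\mid p\mid\,!\varphi\mid\varphi\sqcup\varphi$ with $\|true\|(\alpha)=1$, $\|p\|(\alpha)=\alpha(p)$, $\|!\varphi\|(\alpha)=\overline{\|\varphi\|(\alpha)}$, $\|\varphi_1\sqcup\varphi_2\|(\alpha)=\|\varphi_1\|(\alpha)\vee\|\varphi_2\|(\alpha)$. fPCL formulas: $\zeta::=\varphi\mid\neg\zeta\mid\zeta\oplus\zeta\mid\zeta\uplus\zeta$, $\zeta\otimes\zeta':=\neg(\neg\zeta\oplus\neg\zeta')$, $\sim\zeta:=\zeta\uplus true$; for $\gamma\in fC(P,K)$: $\|\varphi\|(\gamma)=\bigwedge_{\alpha\in\gamma}\|\varphi\|(\alpha)$, $\|\neg\zeta\|(\gamma)=\overline{\|\zeta\|(\gamma)}$, $\|\zeta_1\oplus\zeta_2\|(\gamma)=\|\zeta_1\|(\gamma)\vee\|\zeta_2\|(\gamma)$,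 $\|\zeta_1\uplus\zeta_2\|(\gamma)=\bigvee_{\gamma_1,\gamma_2\in fC(P,K),\,\gamma_1\cup\gamma_2=\gamma}(\|\zeta_1\|(\gamma_1)\wedge\|\zeta_2\|(\gamma_2))$. Indexed operators $\bigsqcup,\biguplus,\bigotimes$ denote iterated binary operators. $\zeta_1\equiv\zeta_2$ means $\|\zeta_1\|(\gamma)=\|\zeta_2\|(\gamma)$ for all $\gamma\in fC(P,K)$, for an arbitrary De Morgan algebra $K$. -}

module Defs where

open import Level using (Level; _⊔_) renaming (suc to lsuc)
open import Data.Nat using (ℕ; zero; suc)
open import Data.Fin using (Fin)
open import Data.Product using (_×_; _,_; ∃)
open import Data.List using (List; []; _∷_; map; foldr; concatMap)
open import Data.List.Relation.Unary.AllPairs using (AllPairs)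
open import Relation.Nullary using (¬_)
open import Relation.Binary using (Rel)
open import Algebra.Core using (Op₁; Op₂)
open import Algebra.Definitions using (Identity; Involutive; Congruent₁)
open import Algebra.Lattice.Structures using (IsDistributiveLattice)

record DeMorganAlgebra c ℓ : Set (lsuc (c ⊔ ℓ)) where
  infixr 7 _∧_
  infixr 6 _∨_
  infix  4 _≈_
  field
    Carrier               : Set c
    _≈_                   : Rel Carrier ℓ
    _∨_                   : Op₂ Carrier
    _∧_                   : Op₂ Carrier
    ‾                     : Op₁ Carrier
    𝟘                     : Carrier
    𝟙                     : Carrier
    isDistributiveLattice : IsDistributiveLattice _≈_ _∨_ _∧_
    ∨-identity            : Identity _≈_ 𝟘 _∨_
    ∧-identity            : Identity _≈_ 𝟙 _∧_
    ‾-cong                : Congruent₁ _≈_ ‾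
    ‾-involutive          : Involutive _≈_ ‾
    deMorgan-∨            : ∀ x y → ‾ (x ∨ y) ≈ ‾ x ∧ ‾ y
    deMorgan-∧            : ∀ x y → ‾ (x ∧ y) ≈ ‾ x ∨ ‾ y

  open IsDistributiveLattice isDistributiveLattice public

module _ (P : Set) where

  data fPIL : Set where
    true : fPIL
    port : P → fPIL
    !_   : fPIL → fPIL
    _⊔ᶠ_ : fPIL → fPIL → fPIL

  data fPCL : Set where
    pil  : fPIL → fPCL
    ¬ᶜ_  : fPCL → fPCL
    _⊕_  : fPCL → fPCL → fPCL
    _⊎ᶜ_ : fPCL → fPCL → fPCL

module _ {P : Set} where

  _⊗_ : fPCL P → fPCL P → fPCL P
  ζ ⊗ ζ' = ¬ᶜ ((¬ᶜ ζ) ⊕ (¬ᶜ ζ'))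

  ∼_ : fPCL P → fPCL P
  ∼ ζ = ζ ⊎ᶜ pil true

  -- iterated binary operators over a nonempty finite index set Fin (suc n)
  -- (right-nested: φ₀ ∘ (φ₁ ∘ (… ∘ φₙ)))
  iter : {A : Set} → (A → A → A) → (n : ℕ) → (Fin (suc n) → A) → A
  iter _∘_ zero    f = f Fin.zero
  iter _∘_ (suc n) f = f Fin.zero ∘ iter _∘_ n (λ j → f (Fin.suc j))

  ⨆ : (n : ℕ) → (Fin (suc n) → fPIL P) → fPIL P
  ⨆ = iter _⊔ᶠ_

  ⨄ : (n : ℕ) → (Fin (suc n) → fPCL P) → fPCL P
  ⨄ = iter _⊎ᶜ_

  ⨂ : (n : ℕ) → (Fin (suc n) → fPCL P) → fPCL P
  ⨂ = iter _⊗_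

module Semantics {c ℓ} (K : DeMorganAlgebra c ℓ) (P : Set) where
  open DeMorganAlgebra K

  record Interaction : Set (c ⊔ ℓ) where
    constructor mkI
    field
      act     : P → Carrier
      nonzero : ∃ λ p → ¬ (act p ≈ 𝟘)
  open Interaction public

  _≈ᴵ_ : Interaction → Interaction → Set ℓ
  α ≈ᴵ β = ∀ p → act α p ≈ act β p

  -- fC(P,K): nonempty finite sets of interactions, represented by
  -- duplicate-free nonempty lists
  record fC : Set (c ⊔ ℓ) where
    constructor mkC
    field
      first    : Interaction
      rest     : List Interaction
      distinct : AllPairs (λ α β → ¬ (α ≈ᴵ β)) (first ∷ rest)
  open fC public

  elems : fC → List Interaction
  elems γ = first γ ∷ rest γ

  ‖_‖ᴵ : fPIL P → Interaction → Carrier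
  ‖ true ‖ᴵ     α = 𝟙
  ‖ port p ‖ᴵ   α = act α p
  ‖ ! φ ‖ᴵ      α = ‾ (‖ φ ‖ᴵ α)
  ‖ φ ⊔ᶠ ψ ‖ᴵ   α = ‖ φ ‖ᴵ α ∨ ‖ ψ ‖ᴵ α

  ⋀ : List Carrier → Carrier
  ⋀ = foldr _∧_ 𝟙

  ⋁ : List Carrier → Carrier
  ⋁ = foldr _∨_ 𝟘

  -- all ways to write a list xs as a cover xs = ys ∪ zs by sublists:
  -- every element goes to the left part, the right part, or both.
  covers : List Interaction → List (List Interaction × List Interaction)
  covers []       = ([] , []) ∷ []
  covers (x ∷ xs) = concatMap
    (λ { (l , r) → (x ∷ l , r) ∷ (l , x ∷ r) ∷ (x ∷ l , x ∷ r) ∷ [] })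
    (covers xs)

  -- semantics on (finite lists representing) sets of interactions;
  -- the empty list is never reached from a nonempty one in ⊎ (see below)
  ⟦_⟧ : fPCL P → List Interaction → Carrier
  ⟦ pil φ ⟧  γ = ⋀ (map ‖ φ ‖ᴵ γ)
  ⟦ ¬ᶜ ζ ⟧   γ = ‾ (⟦ ζ ⟧ γ)
  ⟦ ζ ⊕ ξ ⟧  γ = ⟦ ζ ⟧ γ ∨ ⟦ ξ ⟧ γ
  ⟦ ζ ⊎ᶜ ξ ⟧ γ = ⋁ (map term (covers γ))
    where
    -- only decompositions into two nonempty sets γ₁, γ₂ ∈ fC contribute
    term : List Interaction × List Interaction → Carrier
    term ([]    , _)     = 𝟘
    term (_ ∷ _ , [])    = 𝟘
    term (l@(_ ∷ _) , r@(_ ∷ _)) = ⟦ ζ ⟧ l ∧ ⟦ ξ ⟧ r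

  ‖_‖ : fPCL P → fC → Carrier
  ‖ ζ ‖ γ = ⟦ ζ ⟧ (elems γ)

Equiv : (c ℓ : Level) {P : Set} → fPCL P → fPCL P → Set (lsuc (c ⊔ ℓ))
Equiv c ℓ {P} ζ₁ ζ₂ =
  (K : DeMorganAlgebra c ℓ) →
  let open Semantics K P; open DeMorganAlgebra K in
  (γ : fC) → ‖ ζ₁ ‖ γ ≈ ‖ ζ₂ ‖ γ

-- Call N(hs, f)(γ) := ⋀_{h ∈ hs} ⋁_{α ∈ γ} h(α) ∧ ⋀_{α ∈ γ} f(α) a normal form, where every
-- h ∈ hs lies below f. An fPIL formula φ is in normal form N([φ], φ), and ⊎ preserves normal
-- forms: N(hs, f) ⊎ N(ks, g) = N(hs ++ ks, f ∨ g). Hence ⨄ φⱼ = N([φ₀, …, φₙ], ⨆ φⱼ), while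
-- ∼φⱼ = N([φⱼ, true], φⱼ ∨ true) = ⋁_{α ∈ γ} φⱼ(α), so the right-hand side is the same normal
-- form. The closure of normal forms under ⊎ is an induction over γ in which the elements
-- already put into the two parts of the cover are remembered; distributivity and the
-- bound h ≤ f make the three ways of placing a new element recombine.
module Submission where

open import Defs
open import Level using (Level; _⊔_)
open import Data.Nat using (ℕ; zero; suc)
open import Data.Fin as Fin using (Fin)
open import Data.Product using (_×_; _,_; proj₁; proj₂)
open import Data.List using (List; []; _∷_; _++_; map; concatMap; tabulate)
open import Data.List.Relation.Unary.All as All using (All; []; _∷_)
open import Algebra.Bundles using (CommutativeSemigroup)
import Algebra.Properties.CommutativeSemigroup as CommutativeSemigroupProperties
open import Algebra.Lattice.Bundles using (Lattice)
import Algebra.Lattice.Properties.Lattice as LatticeProperties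
open import Relation.Binary.Bundles using (Poset)
import Relation.Binary.Lattice as OrderTheoretic

module Order {c ℓ} (K : DeMorganAlgebra c ℓ) where
  open DeMorganAlgebra K

  lattice : Lattice c ℓ
  lattice = record { isLattice = isLattice }

  open LatticeProperties lattice
    using (poset; ∨-∧-isOrderTheoreticLattice; ∧-isSemigroup; ∨-isSemigroup)
  open Poset poset public
    using (_≤_)
    renaming (refl to ≤-refl; trans to ≤-trans; antisym to ≤-antisym; reflexive to ≤-reflexive)
  open OrderTheoretic.IsLattice ∨-∧-isOrderTheoreticLattice
    using (x≤x∨y; y≤x∨y; ∨-least; x∧y≤x; x∧y≤y; ∧-greatest)

  ∧-commutativeSemigroup : CommutativeSemigroup c ℓ
  ∧-commutativeSemigroup = record
    { isCommutativeSemigroup = record { isSemigroup = ∧-isSemigroup ; comm = ∧-comm } }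

  ∨-commutativeSemigroup : CommutativeSemigroup c ℓ
  ∨-commutativeSemigroup = record
    { isCommutativeSemigroup = record { isSemigroup = ∨-isSemigroup ; comm = ∨-comm } }

  open CommutativeSemigroupProperties ∧-commutativeSemigroup public
    using () renaming (x∙yz≈y∙xz to x∧yz≈y∧xz; interchange to ∧-interchange)
  open CommutativeSemigroupProperties ∨-commutativeSemigroup public
    using () renaming (x∙yz≈y∙xz to x∨yz≈y∨xz; interchange to ∨-interchange)

  -- The order read as a thin category: ∧ is the product and ∨ the coproduct.
  infixr 4 _⨾_
  _⨾_ : ∀ {x y z} → x ≤ y → y ≤ z → x ≤ z
  _⨾_ = ≤-trans

  π₁ : ∀ {x y} → x ∧ y ≤ x
  π₁ = x∧y≤x _ _

  π₂ : ∀ {x y} → x ∧ y ≤ y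
  π₂ = x∧y≤y _ _

  ι₁ : ∀ {x y} → x ≤ x ∨ y
  ι₁ = x≤x∨y _ _

  ι₂ : ∀ {x y} → y ≤ x ∨ y
  ι₂ = y≤x∨y _ _

  ⟨_,_⟩ : ∀ {x y z} → z ≤ x → z ≤ y → z ≤ x ∧ y
  ⟨ p , q ⟩ = ∧-greatest p q

  [_,_] : ∀ {x y z} → x ≤ z → y ≤ z → x ∨ y ≤ z
  [ p , q ] = ∨-least p q

  𝟘≤ : ∀ {x} → 𝟘 ≤ x
  𝟘≤ {x} = ι₁ ⨾ ≤-reflexive (proj₁ ∨-identity x)

  ≤𝟙 : ∀ {x} → x ≤ 𝟙
  ≤𝟙 {x} = ≤-reflexive (sym (proj₂ ∧-identity x)) ⨾ π₂

  ∧-mono : ∀ {x x' y y'} → x ≤ x' → y ≤ y' → x ∧ y ≤ x' ∧ y'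
  ∧-mono p q = ⟨ π₁ ⨾ p , π₂ ⨾ q ⟩

  by-cases : ∀ {x y z w} → x ≤ y ∨ z → x ∧ y ≤ w → x ∧ z ≤ w → x ≤ w
  by-cases split p q = ⟨ ≤-refl , split ⟩ ⨾ ≤-reflexive (∧-distribˡ-∨ _ _ _) ⨾ [ p , q ]

  ⊗-meet : ∀ x y → ‾ (‾ x ∨ ‾ y) ≈ x ∧ y
  ⊗-meet x y = trans (deMorgan-∨ _ _) (∧-cong (‾-involutive x) (‾-involutive y))

  -- u and v are the weights of a new element put into the left resp. right part of a
  -- cover; a ≤ a' ≤ a ∨ u and b ≤ b' ≤ b ∨ v say how it changes the joins on either side.
  cover-recombine : ∀ {u v a a' b b' m} → a ≤ a' → a' ≤ a ∨ u → b ≤ b' → b' ≤ b ∨ v →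
    (u ∧ ((a' ∧ b) ∧ m)) ∨ ((v ∧ ((a ∧ b') ∧ m)) ∨ ((u ∧ v) ∧ ((a' ∧ b') ∧ m)))
      ≈ (a' ∧ b') ∧ ((u ∨ v) ∧ m)
  cover-recombine a≤a' a'≤a∨u b≤b' b'≤b∨v = ≤-antisym
    [ ⟨ ⟨ π₂ ⨾ π₁ ⨾ π₁ , π₂ ⨾ π₁ ⨾ π₂ ⨾ b≤b' ⟩ , ⟨ π₁ ⨾ ι₁ , π₂ ⨾ π₂ ⟩ ⟩
    , [ ⟨ ⟨ π₂ ⨾ π₁ ⨾ π₁ ⨾ a≤a' , π₂ ⨾ π₁ ⨾ π₂ ⟩ , ⟨ π₁ ⨾ ι₂ , π₂ ⨾ π₂ ⟩ ⟩
      , ⟨ π₂ ⨾ π₁ , ⟨ π₁ ⨾ π₁ ⨾ ι₁ , π₂ ⨾ π₂ ⟩ ⟩ ] ]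
    (by-cases (π₂ ⨾ π₁)
      (by-cases (π₁ ⨾ π₁ ⨾ π₂ ⨾ b'≤b∨v)
        (⟨ π₁ ⨾ π₂ , ⟨ ⟨ π₁ ⨾ π₁ ⨾ π₁ ⨾ π₁ , π₂ ⟩ , π₁ ⨾ π₁ ⨾ π₂ ⨾ π₂ ⟩ ⟩ ⨾ ι₁)
        (⟨ ⟨ π₁ ⨾ π₂ , π₂ ⟩ , ⟨ π₁ ⨾ π₁ ⨾ π₁ , π₁ ⨾ π₁ ⨾ π₂ ⨾ π₂ ⟩ ⟩ ⨾ ι₂ ⨾ ι₂))
      (by-cases (π₁ ⨾ π₁ ⨾ π₁ ⨾ a'≤a∨u)
        (⟨ π₁ ⨾ π₂ , ⟨ ⟨ π₂ , π₁ ⨾ π₁ ⨾ π₁ ⨾ π₂ ⟩ , π₁ ⨾ π₁ ⨾ π₂ ⨾ π₂ ⟩ ⟩ ⨾ ι₁ ⨾ ι₂)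
        (⟨ ⟨ π₂ , π₁ ⨾ π₂ ⟩ , ⟨ π₁ ⨾ π₁ ⨾ π₁ , π₁ ⨾ π₁ ⨾ π₂ ⨾ π₂ ⟩ ⟩ ⨾ ι₂ ⨾ ι₂)))

module NormalForm {c ℓ} (K : DeMorganAlgebra c ℓ) (P : Set) where
  open DeMorganAlgebra K
  open Semantics K P
  open Order K
  open import Relation.Binary.Reasoning.Setoid (Lattice.setoid lattice)

  module _ {a} {A : Set a} where
    ⋁-map-cong : {s t : A → Carrier} → (∀ p → s p ≈ t p) → ∀ ps → ⋁ (map s ps) ≈ ⋁ (map t ps)
    ⋁-map-cong s≈t []       = refl
    ⋁-map-cong s≈t (p ∷ ps) = ∨-cong (s≈t p) (⋁-map-cong s≈t ps)

    ⋁-map-++ : (t : A → Carrier) → ∀ ps qs → ⋁ (map t (ps ++ qs)) ≈ ⋁ (map t ps) ∨ ⋁ (map t qs)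
    ⋁-map-++ t []       qs = sym (proj₁ ∨-identity _)
    ⋁-map-++ t (p ∷ ps) qs = trans (∨-cong refl (⋁-map-++ t ps qs)) (sym (∨-assoc _ _ _))

    ⋁-map-shift : (t : A → Carrier) → ∀ ps q qs → ⋁ (map t (ps ++ q ∷ qs)) ≈ ⋁ (map t (q ∷ ps ++ qs))
    ⋁-map-shift t []       q qs = refl
    ⋁-map-shift t (p ∷ ps) q qs = trans (∨-cong refl (⋁-map-shift t ps q qs)) (x∨yz≈y∨xz _ _ _)

    ⋁-map-∨ : (s t : A → Carrier) → ∀ ps → ⋁ (map (λ p → s p ∨ t p) ps) ≈ ⋁ (map s ps) ∨ ⋁ (map t ps)
    ⋁-map-∨ s t []       = sym (proj₁ ∨-identity _)
    ⋁-map-∨ s t (p ∷ ps) = trans (∨-cong refl (⋁-map-∨ s t ps)) (∨-interchange _ _ _ _)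

    ⋁-map-∧ˡ : (k : Carrier) (t : A → Carrier) → ∀ ps → ⋁ (map (λ p → k ∧ t p) ps) ≈ k ∧ ⋁ (map t ps)
    ⋁-map-∧ˡ k t []       = ≤-antisym 𝟘≤ π₂
    ⋁-map-∧ˡ k t (p ∷ ps) = trans (∨-cong refl (⋁-map-∧ˡ k t ps)) (sym (∧-distribˡ-∨ _ _ _))

    ⋀-map-++ : (t : A → Carrier) → ∀ ps qs → ⋀ (map t (ps ++ qs)) ≈ ⋀ (map t ps) ∧ ⋀ (map t qs)
    ⋀-map-++ t []       qs = sym (proj₁ ∧-identity _)
    ⋀-map-++ t (p ∷ ps) qs = trans (∧-cong refl (⋀-map-++ t ps qs)) (sym (∧-assoc _ _ _))

    ≤-⋀-map : ∀ {z} (t : A → Carrier) → (∀ p → z ≤ t p) → ∀ ps → z ≤ ⋀ (map t ps)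
    ≤-⋀-map t z≤t []       = ≤𝟙
    ≤-⋀-map t z≤t (p ∷ ps) = ⟨ z≤t p , ≤-⋀-map t z≤t ps ⟩

  module _ {a b} {A : Set a} {B : Set b} where
    ⋁-map-concatMap : (t : B → Carrier) (k : A → List B) → ∀ ps →
      ⋁ (map t (concatMap k ps)) ≈ ⋁ (map (λ p → ⋁ (map t (k p))) ps)
    ⋁-map-concatMap t k []       = refl
    ⋁-map-concatMap t k (p ∷ ps) =
      trans (⋁-map-++ t (k p) (concatMap k ps)) (∨-cong refl (⋁-map-concatMap t k ps))

  Weight : Set (c ⊔ ℓ)
  Weight = Interaction → Carrier

  _∨̇_ : Weight → Weight → Weight
  (f ∨̇ g) α = f α ∨ g α

  _≤̇_ : Weight → Weight → Set (c ⊔ ℓ)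
  f ≤̇ g = ∀ α → f α ≤ g α

  ⋁⟨_⟩ : Weight → List Interaction → Carrier
  ⋁⟨ h ⟩ γ = ⋁ (map h γ)

  ⋀⟨_⟩ : Weight → List Interaction → Carrier
  ⋀⟨ h ⟩ γ = ⋀ (map h γ)

  ⋀⋁ : List Weight → List Interaction → Carrier
  ⋀⋁ hs γ = ⋀ (map (λ h → ⋁⟨ h ⟩ γ) hs)

  normal : List Weight → Weight → List Interaction → Carrier
  normal hs f γ = ⋀⋁ hs γ ∧ ⋀⟨ f ⟩ γ

  ⋀⋁-shift : ∀ hs σ x γ → ⋀⋁ hs (σ ++ x ∷ γ) ≈ ⋀⋁ hs (x ∷ σ ++ γ)
  ⋀⋁-shift []       σ x γ = refl
  ⋀⋁-shift (h ∷ hs) σ x γ = ∧-cong (⋁-map-shift h σ x γ) (⋀⋁-shift hs σ x γ)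

  ⋀⋁-≤-cons : ∀ hs x γ → ⋀⋁ hs γ ≤ ⋀⋁ hs (x ∷ γ)
  ⋀⋁-≤-cons []       x γ = ≤-refl
  ⋀⋁-≤-cons (h ∷ hs) x γ = ∧-mono ι₂ (⋀⋁-≤-cons hs x γ)

  ⋀⋁-cons-≤-∨ : ∀ {f hs} → All (_≤̇ f) hs → ∀ x γ → ⋀⋁ hs (x ∷ γ) ≤ ⋀⋁ hs γ ∨ f x
  ⋀⋁-cons-≤-∨ []           x γ = ι₁
  ⋀⋁-cons-≤-∨ (h≤f ∷ hs≤f) x γ =
    ∧-mono [ h≤f x ⨾ ι₂ , ι₁ ] (⋀⋁-cons-≤-∨ hs≤f x γ) ⨾ ≤-reflexive (sym (∨-distribʳ-∧ _ _ _))

  -- σ lists the elements already placed into the part weighted by hs and f.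
  side : List Weight → Weight → List Interaction → List Interaction → Carrier
  side hs f σ l = ⋀⋁ hs (σ ++ l) ∧ ⋀⟨ f ⟩ l

  side-cons : ∀ hs f σ x l → side hs f σ (x ∷ l) ≈ f x ∧ side hs f (x ∷ σ) l
  side-cons hs f σ x l = trans (∧-cong (⋀⋁-shift hs σ x l) refl) (x∧yz≈y∧xz _ _ _)

  module Covers {f g : Weight} {hs ks : List Weight} (hs≤f : All (_≤̇ f) hs) (ks≤g : All (_≤̇ g) ks) where
    part : List Interaction → List Interaction → List Interaction × List Interaction → Carrier
    part σ ρ (l , r) = side hs f σ l ∧ side ks g ρ r

    whole : List Interaction → List Interaction → List Interaction → Carrier
    whole σ ρ γ = (⋀⋁ hs (σ ++ γ) ∧ ⋀⋁ ks (ρ ++ γ)) ∧ ⋀⟨ f ∨̇ g ⟩ γ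

    part-spread : ∀ σ ρ x l r →
      part σ ρ (x ∷ l , r) ∨ (part σ ρ (l , x ∷ r) ∨ (part σ ρ (x ∷ l , x ∷ r) ∨ 𝟘))
        ≈ (f x ∧ part (x ∷ σ) ρ (l , r))
          ∨ ((g x ∧ part σ (x ∷ ρ) (l , r)) ∨ ((f x ∧ g x) ∧ part (x ∷ σ) (x ∷ ρ) (l , r)))
    part-spread σ ρ x l r = ∨-cong left (∨-cong right (trans (proj₂ ∨-identity _) both))
      where
      left : part σ ρ (x ∷ l , r) ≈ f x ∧ part (x ∷ σ) ρ (l , r)
      left = trans (∧-cong (side-cons hs f σ x l) refl) (∧-assoc _ _ _)
      right : part σ ρ (l , x ∷ r) ≈ g x ∧ part σ (x ∷ ρ) (l , r)
      right = trans (∧-cong refl (side-cons ks g ρ x r)) (x∧yz≈y∧xz _ _ _)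
      both : part σ ρ (x ∷ l , x ∷ r) ≈ (f x ∧ g x) ∧ part (x ∷ σ) (x ∷ ρ) (l , r)
      both = trans (∧-cong (side-cons hs f σ x l) (side-cons ks g ρ x r)) (∧-interchange _ _ _ _)

    ⋁-covers : ∀ σ ρ γ → ⋁ (map (part σ ρ) (covers γ)) ≈ whole σ ρ γ
    ⋁-covers σ ρ [] = ≤-antisym
      [ ⟨ ⟨ π₁ ⨾ π₁ , π₂ ⨾ π₁ ⟩ , ≤𝟙 ⟩ , 𝟘≤ ]
      (⟨ ⟨ π₁ ⨾ π₁ , ≤𝟙 ⟩ , ⟨ π₁ ⨾ π₂ , ≤𝟙 ⟩ ⟩ ⨾ ι₁)
    ⋁-covers σ ρ (x ∷ γ) = begin
      ⋁ (map (part σ ρ) (covers (x ∷ γ)))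
        ≈⟨ trans (⋁-map-concatMap (part σ ρ) _ (covers γ))
                 (⋁-map-cong (λ { (l , r) → part-spread σ ρ x l r }) (covers γ)) ⟩
      ⋁ (map (λ p → (f x ∧ part (x ∷ σ) ρ p)
                    ∨ ((g x ∧ part σ (x ∷ ρ) p) ∨ ((f x ∧ g x) ∧ part (x ∷ σ) (x ∷ ρ) p)))
             (covers γ))
        ≈⟨ ⋁-map-∨ _ _ (covers γ) ⟩
      ⋁ (map (λ p → f x ∧ part (x ∷ σ) ρ p) (covers γ))
        ∨ ⋁ (map (λ p → (g x ∧ part σ (x ∷ ρ) p) ∨ ((f x ∧ g x) ∧ part (x ∷ σ) (x ∷ ρ) p)) (covers γ))
        ≈⟨ ∨-cong (⋁-map-∧ˡ _ _ (covers γ)) (⋁-map-∨ _ _ (covers γ)) ⟩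
      (f x ∧ ⋁ (map (part (x ∷ σ) ρ) (covers γ)))
        ∨ (⋁ (map (λ p → g x ∧ part σ (x ∷ ρ) p) (covers γ))
           ∨ ⋁ (map (λ p → (f x ∧ g x) ∧ part (x ∷ σ) (x ∷ ρ) p) (covers γ)))
        ≈⟨ ∨-cong (∧-cong refl (⋁-covers (x ∷ σ) ρ γ))
             (∨-cong (trans (⋁-map-∧ˡ _ _ (covers γ)) (∧-cong refl (⋁-covers σ (x ∷ ρ) γ)))
                     (trans (⋁-map-∧ˡ _ _ (covers γ)) (∧-cong refl (⋁-covers (x ∷ σ) (x ∷ ρ) γ)))) ⟩
      (f x ∧ whole (x ∷ σ) ρ γ)
        ∨ ((g x ∧ whole σ (x ∷ ρ) γ) ∨ ((f x ∧ g x) ∧ whole (x ∷ σ) (x ∷ ρ) γ))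
        ≈⟨ cover-recombine (⋀⋁-≤-cons hs x (σ ++ γ)) (⋀⋁-cons-≤-∨ hs≤f x (σ ++ γ))
                           (⋀⋁-≤-cons ks x (ρ ++ γ)) (⋀⋁-cons-≤-∨ ks≤g x (ρ ++ γ)) ⟩
      (⋀⋁ hs (x ∷ σ ++ γ) ∧ ⋀⋁ ks (x ∷ ρ ++ γ)) ∧ ⋀⟨ f ∨̇ g ⟩ (x ∷ γ)
        ≈⟨ ∧-cong (∧-cong (⋀⋁-shift hs σ x γ) (⋀⋁-shift ks ρ x γ)) refl ⟨
      whole σ ρ (x ∷ γ) ∎

  -- Since hs and ks are nonempty, both normal forms vanish on [], as ⊎ requires of covers
  -- with an empty part.
  ⊎-normal : ∀ {ζ ξ f g h k hs ks} →
    (∀ x γ → ⟦ ζ ⟧ (x ∷ γ) ≈ normal (h ∷ hs) f (x ∷ γ)) →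
    (∀ x γ → ⟦ ξ ⟧ (x ∷ γ) ≈ normal (k ∷ ks) g (x ∷ γ)) →
    All (_≤̇ f) (h ∷ hs) → All (_≤̇ g) (k ∷ ks) →
    ∀ x γ → ⟦ ζ ⊎ᶜ ξ ⟧ (x ∷ γ) ≈ normal ((h ∷ hs) ++ (k ∷ ks)) (f ∨̇ g) (x ∷ γ)
  ⊎-normal {f = f} {g} {h} {k} {hs} {ks} ζ-normal ξ-normal hs≤f ks≤g x γ = begin
    ⟦ _ ⊎ᶜ _ ⟧ (x ∷ γ)
      ≈⟨ ⋁-map-cong (λ { ([] , r)         → ≤-antisym 𝟘≤ (π₁ ⨾ π₁ ⨾ π₁)
                       ; (_ ∷ _ , [])     → ≤-antisym 𝟘≤ (π₂ ⨾ π₁ ⨾ π₁)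
                       ; (y ∷ l , z ∷ r) → ∧-cong (ζ-normal y l) (ξ-normal z r) })
                    (covers (x ∷ γ)) ⟩
    ⋁ (map (part [] []) (covers (x ∷ γ)))
      ≈⟨ ⋁-covers [] [] (x ∷ γ) ⟩
    (⋀⋁ (h ∷ hs) (x ∷ γ) ∧ ⋀⋁ (k ∷ ks) (x ∷ γ)) ∧ ⋀⟨ f ∨̇ g ⟩ (x ∷ γ)
      ≈⟨ ∧-cong (⋀-map-++ (λ w → ⋁⟨ w ⟩ (x ∷ γ)) (h ∷ hs) (k ∷ ks)) refl ⟨
    normal ((h ∷ hs) ++ (k ∷ ks)) (f ∨̇ g) (x ∷ γ) ∎
    where open Covers hs≤f ks≤g

  pil-normal : ∀ φ x γ → ⟦ pil φ ⟧ (x ∷ γ) ≈ normal (‖ φ ‖ᴵ ∷ []) ‖ φ ‖ᴵ (x ∷ γ)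
  pil-normal φ x γ = ≤-antisym ⟨ ⟨ π₁ ⨾ ι₁ , ≤𝟙 ⟩ , ≤-refl ⟩ π₂

  ∼pil-join : ∀ φ x γ → ⟦ ∼ pil φ ⟧ (x ∷ γ) ≈ ⋁⟨ ‖ φ ‖ᴵ ⟩ (x ∷ γ)
  ∼pil-join φ x γ =
    trans (⊎-normal (pil-normal φ) (pil-normal true) ((λ _ → ≤-refl) ∷ []) ((λ _ → ≤-refl) ∷ []) x γ)
      (≤-antisym (π₁ ⨾ π₁)
        ⟨ ⟨ ≤-refl , ⟨ ≤𝟙 ⨾ ι₁ , ≤𝟙 ⟩ ⟩ , ≤-⋀-map _ (λ _ → ≤𝟙 ⨾ ι₂) (x ∷ γ) ⟩)

  ‖_‖ᴵs : ∀ {n} → (Fin n → fPIL P) → List Weight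
  ‖ φ ‖ᴵs = tabulate (λ j → ‖ φ j ‖ᴵ)

  ⨆-upper : ∀ n φ → All (_≤̇ ‖ ⨆ n φ ‖ᴵ) ‖ φ ‖ᴵs
  ⨆-upper zero    φ = (λ _ → ≤-refl) ∷ []
  ⨆-upper (suc n) φ = (λ _ → ι₁) ∷ All.map (λ h≤ α → h≤ α ⨾ ι₂) (⨆-upper n (λ j → φ (Fin.suc j)))

  ⨄-normal : ∀ n φ x γ → ⟦ ⨄ n (λ j → pil (φ j)) ⟧ (x ∷ γ) ≈ normal ‖ φ ‖ᴵs ‖ ⨆ n φ ‖ᴵ (x ∷ γ)
  ⨄-normal zero    φ = pil-normal (φ Fin.zero)
  ⨄-normal (suc n) φ = ⊎-normal (pil-normal (φ Fin.zero)) (⨄-normal n (λ j → φ (Fin.suc j)))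
    ((λ _ → ≤-refl) ∷ []) (⨆-upper n (λ j → φ (Fin.suc j)))

  ⨂∼-meet : ∀ n φ x γ → ⟦ ⨂ n (λ j → ∼ pil (φ j)) ⟧ (x ∷ γ) ≈ ⋀⋁ ‖ φ ‖ᴵs (x ∷ γ)
  ⨂∼-meet zero    φ x γ = trans (∼pil-join (φ Fin.zero) x γ) (sym (proj₂ ∧-identity _))
  ⨂∼-meet (suc n) φ x γ = trans (⊗-meet _ _)
    (∧-cong (∼pil-join (φ Fin.zero) x γ) (⨂∼-meet n (λ j → φ (Fin.suc j)) x γ))

mainTheorem15 : {c ℓ : Level} {P : Set} (n : ℕ) (φ : Fin (suc n) → fPIL P) →
    Equiv c ℓ (⨄ n (λ j → pil (φ j))) (⨂ n (λ j → ∼ pil (φ j)) ⊗ pil (⨆ n φ))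
mainTheorem15 {P = P} n φ K γ =
  trans (⨄-normal n φ (first γ) (rest γ))
    (sym (trans (⊗-meet _ _) (∧-cong (⨂∼-meet n φ (first γ) (rest γ)) refl)))
  where
  open DeMorganAlgebra K
  open Order K
  open NormalForm K P
  open Semantics K P
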